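{- Let $(\mathcal{Y},\eta)$ be an $(n,m)$-voltage operator and let $\tau\in\mathrm{Aut}(\mathcal{Y})$ be such that there exists a group homomorphism $\tau^\#:\mathcal{C}^n\to\mathcal{C}^n$ with $\tau^\#(\eta(W))=\eta(W\tau)$ for every $W\in\Pi(\mathcal{Y})$. Then for every $n$-premaniplex $\mathcal{X}$, the premaniplex $\mathcal{X}^{\tau^\#}\rtimes_\eta\mathcal{Y}$ is isomorphic to $\mathcal{X}\rtimes_\eta\mathcal{Y}$.
   Context: A graph may have multiple edges and semi-edges. An $n$-premaniplex is such a graph with edges coloured by $\{0,\dots,n-1\}$ so that every vertex (flag) is the starting point of exactly one dart of each colour, and whenever $|i-j|\ge2$ every alternating path of length 4 with colours $i,j$ is closed; $x^i$ is the end of the $i$-dart at $x$. $\mathcal{C}^n=\langle r_0,\dots,r_{n-1}\mid r_i^2=1,\ (r_ir_j)^2=1\ (|i-j|\ge2)\rangle$ acts on the left on flags by $r_ix=x^i$. Isomorphisms are bijections of flags preserving all $i$-adjacencies; automorphisms act on the right and $\tau\in\mathrm{Aut}(\mathcal{Y})$ maps each path $W$ to a path $W\tau$. For a flag $y$ of an $m$-premaniplex $\mathcal{Y}$ and $\omega\in\mathcal{C}^m$, $P_\omega(y)$ is the homotopy class of paths from $y$ whose successive colours $i_1,\dots,i_k$ satisfy $r_{i_k}\cdots r_{i_1}=\omega$ (homotopic iff same start and same element of $\mathcal{C}^m$); these form the fundamental groupoid $\Pi(\mathcal{Y})$. A voltage assignment $\eta:\Pi(\mathcal{Y})\to\mathcal{C}^n$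 satisfies $\eta(W_1W_2)=\eta(W_2)\eta(W_1)$; $(\mathcal{Y},\eta)$ is an $(n,m)$-voltage operator. $\mathcal{X}\rtimes_\eta\mathcal{Y}$ is the $m$-premaniplex with flags $\mathcal{X}\times\mathcal{Y}$ and $(x,y)^i=(\eta(P_{r_i}(y))x,y^i)$. For a homomorphism $\tau^\#:\mathcal{C}^n\to\mathcal{C}^n$, $\mathcal{X}^{\tau^\#}$ is the $n$-premaniplex with the same flags as $\mathcal{X}$ and $i$-adjacency $x\mapsto\tau^\#(r_i)x$ (equivalently, $\mathcal{X}\rtimes_{\tau^\#}\mathbf{1}^n$, where $\mathbf{1}^n$ is the one-flag premaniplex whose $i$-semi-edge has voltage $\tau^\#(r_i)$). Standing assumption: $\mathcal{Y}$ has a spanning tree (forest if disconnected) all of whose darts have trivial voltage. -}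

module Defs where

open import Data.Nat using (ℕ; _+_; _≤_)
open import Data.Fin using (Fin; toℕ)
open import Data.List using (List; []; _∷_; _++_; reverse)
open import Data.Sum using (_⊎_)
open import Data.Product using (_×_; _,_)
open import Relation.Binary.PropositionalEquality using (_≡_)

Far : ∀ {n} → Fin n → Fin n → Set
Far i j = (2 + toℕ i ≤ toℕ j) ⊎ (2 + toℕ j ≤ toℕ i)

-- The group C^n, presented as words in the generators modulo the
-- congruence generated by its defining relations (a setoid).
-- The word  a₁ ∷ a₂ ∷ … ∷ aₖ ∷ []  denotes r_{a₁} r_{a₂} ⋯ r_{aₖ};
-- multiplication is _++_ and the identity is [].

Word : ℕ → Set
Word n = List (Fin n)

infix 4 _≈_
data _≈_ {n : ℕ} : Word n → Word n → Set where
  ≈-refl  : ∀ {u} → u ≈ u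
  ≈-sym   : ∀ {u v} → u ≈ v → v ≈ u
  ≈-trans : ∀ {u v w} → u ≈ v → v ≈ w → u ≈ w
  ≈-cong  : ∀ {u u′ v v′} → u ≈ u′ → v ≈ v′ → u ++ v ≈ u′ ++ v′
  ≈-inv   : ∀ i → i ∷ i ∷ [] ≈ []
  ≈-far   : ∀ i j → Far i j → i ∷ j ∷ i ∷ j ∷ [] ≈ []

record IsHom {n : ℕ} (h : Word n → Word n) : Set where
  field
    hom-cong : ∀ {u v} → u ≈ v → h u ≈ h v
    hom-mult : ∀ u v → h (u ++ v) ≈ h u ++ h v

-- Edge-coloured graphs given by their dart functions:
-- adj i x = x^i, the end of the i-dart at x.

record Graph (n : ℕ) : Set₁ where
  field
    Flag : Set
    adj  : Fin n → Flag → Flag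

act : ∀ {n} (G : Graph n) → Word n → Graph.Flag G → Graph.Flag G
act G [] x = x
act G (i ∷ w) x = Graph.adj G i (act G w x)

record IsPremaniplex {n : ℕ} (G : Graph n) : Set where
  open Graph G
  field
    adj-invol : ∀ i x → adj i (adj i x) ≡ x
    adj-far   : ∀ i j → Far i j → ∀ x → adj i (adj j (adj i (adj j x))) ≡ x

record Premaniplex (n : ℕ) : Set₁ where
  field
    graph         : Graph n
    isPremaniplex : IsPremaniplex graph
  open Graph graph public

record Isomorphism {n : ℕ} (G H : Graph n) : Set where
  field
    to      : Graph.Flag G → Graph.Flag H
    from    : Graph.Flag H → Graph.Flag G
    from∘to : ∀ x → from (to x) ≡ x
    to∘from : ∀ y → to (from y) ≡ y
    to-adj  : ∀ i x → to (Graph.adj G i x) ≡ Graph.adj H i (to x)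

Automorphism : ∀ {n} → Graph n → Set
Automorphism G = Isomorphism G G

-- Paths and the fundamental groupoid.
-- A path is determined by its start flag and its colour sequence
-- i₁, …, iₖ (in travel order).

record Path {m : ℕ} (G : Graph m) : Set where
  constructor path
  field
    start   : Graph.Flag G
    colours : List (Fin m)
open Path public

-- the element r_{iₖ} ⋯ r_{i₁} of C^m
pathWord : ∀ {m} {G : Graph m} → Path G → Word m
pathWord p = reverse (colours p)

pathEnd : ∀ {m} {G : Graph m} → Path G → Graph.Flag G
pathEnd {G = G} p = act G (pathWord p) (start p)

Homotopic : ∀ {m} {G : Graph m} → Path G → Path G → Set
Homotopic p q = (start p ≡ start q) × (pathWord p ≈ pathWord q)

-- concatenation W₁W₂ (meaningful when W₂ starts at the end of W₁)
_·_ : ∀ {m} {G : Graph m} → Path G → Path G → Path G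
p · q = path (start p) (colours p ++ colours q)

_▸_ : ∀ {m} {G : Graph m} → Path G → Automorphism G → Path G
p ▸ τ = path (Isomorphism.to τ (start p)) (colours p)

record VoltageOperator (n m : ℕ) : Set₁ where
  field
    Y          : Premaniplex m
    η          : Path (Premaniplex.graph Y) → Word n
    η-homotopy : ∀ {p q} → Homotopic p q → η p ≈ η q
    η-concat   : ∀ p q → start q ≡ pathEnd p → η (p · q) ≈ η q ++ η p

twist : ∀ {n} → Graph n → (Word n → Word n) → Graph n
twist X h = record { Flag = Graph.Flag X ; adj = λ i → act X (h (i ∷ [])) }

_⋊_ : ∀ {n m} → Graph n → VoltageOperator n m → Graph m
X ⋊ V = record
  { Flag = Graph.Flag X × Premaniplex.Flag Y
  ; adj  = λ i xy → ( act X (η (path (proj₂′ xy) (i ∷ []))) (proj₁′ xy)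
                    , Premaniplex.adj Y i (proj₂′ xy)) }
  where
    open VoltageOperator V
    proj₁′ : Graph.Flag X × Premaniplex.Flag Y → Graph.Flag X
    proj₁′ (x , _) = x
    proj₂′ : Graph.Flag X × Premaniplex.Flag Y → Premaniplex.Flag Y
    proj₂′ (_ , y) = y

{-# OPTIONS --safe #-}
module Submission where

open import Defs
open import Data.List using ([]; _∷_; _++_; [_]; reverse)
open import Data.List.Properties using (++-assoc; ++-identityʳ; unfold-reverse)
open import Data.Nat using (ℕ)
open import Data.Product using (_,_)
open import Relation.Binary.Bundles using (Setoid)
open import Relation.Binary.PropositionalEquality
  using (_≡_; refl; sym; trans; cong; cong₂; module ≡-Reasoning)
import Relation.Binary.Reasoning.Setoid as SetoidReasoning

-- The map (x , y) ↦ (x , y τ) is the isomorphism: the i-dart of (x , y) in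
-- X^{τ#} ⋊ Y moves x by τ#(η(P_{r_i}(y))) = η(P_{r_i}(y τ)), which is exactly
-- how the i-dart of (x , y τ) in X ⋊ Y moves x.

Cⁿ : ℕ → Setoid _ _
Cⁿ n = record
  { Carrier       = Word n
  ; _≈_           = _≈_
  ; isEquivalence = record { refl = ≈-refl ; sym = ≈-sym ; trans = ≈-trans }
  }

module _ {n : ℕ} where
  open SetoidReasoning (Cⁿ n)

  -- the generators are involutions, so reversing a word inverts it
  reverse-inverseˡ : (u : Word n) → reverse u ++ u ≈ []
  reverse-inverseˡ []      = ≈-refl
  reverse-inverseˡ (i ∷ u) = begin
    reverse (i ∷ u) ++ i ∷ u       ≡⟨ cong (_++ i ∷ u) (unfold-reverse i u) ⟩
    (reverse u ++ [ i ]) ++ i ∷ u  ≡⟨ ++-assoc (reverse u) [ i ] (i ∷ u) ⟩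
    reverse u ++ (i ∷ i ∷ []) ++ u ≈⟨ ≈-cong (≈-refl {u = reverse u}) (≈-cong (≈-inv i) ≈-refl) ⟩
    reverse u ++ u                 ≈⟨ reverse-inverseˡ u ⟩
    []                             ∎

  ++-cancelˡ : (u : Word n) {v w : Word n} → u ++ v ≈ u ++ w → v ≈ w
  ++-cancelˡ u {v} {w} uv≈uw = begin
    v                         ≈⟨ ≈-cong (reverse-inverseˡ u) ≈-refl ⟨
    (reverse u ++ u) ++ v     ≡⟨ ++-assoc (reverse u) u v ⟩
    reverse u ++ (u ++ v)     ≈⟨ ≈-cong (≈-refl {u = reverse u}) uv≈uw ⟩
    reverse u ++ (u ++ w)     ≡⟨ ++-assoc (reverse u) u w ⟨
    (reverse u ++ u) ++ w     ≈⟨ ≈-cong (reverse-inverseˡ u) ≈-refl ⟩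
    w                         ∎

  hom-identity : {h : Word n → Word n} → IsHom h → h [] ≈ []
  hom-identity {h} isHom = ++-cancelˡ (h []) (begin
    h [] ++ h []  ≈⟨ IsHom.hom-mult isHom [] [] ⟨
    h []          ≡⟨ ++-identityʳ (h []) ⟨
    h [] ++ []    ∎)

act-++ : ∀ {n} (G : Graph n) (u v : Word n) x → act G (u ++ v) x ≡ act G u (act G v x)
act-++ G []      v x = refl
act-++ G (i ∷ u) v x = cong (Graph.adj G i) (act-++ G u v x)

module _ {n : ℕ} (X : Premaniplex n) where
  open Premaniplex X
  open IsPremaniplex isPremaniplex

  act-cong : {u v : Word n} → u ≈ v → ∀ x → act graph u x ≡ act graph v x
  act-cong ≈-refl              x = refl
  act-cong (≈-sym u≈v)         x = sym (act-cong u≈v x)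
  act-cong (≈-trans u≈v v≈w)   x = trans (act-cong u≈v x) (act-cong v≈w x)
  act-cong (≈-inv i)           x = adj-invol i x
  act-cong (≈-far i j far)     x = adj-far i j far x
  act-cong (≈-cong {u} {u′} {v} {v′} u≈u′ v≈v′) x = begin
    act graph (u ++ v) x          ≡⟨ act-++ graph u v x ⟩
    act graph u (act graph v x)   ≡⟨ act-cong u≈u′ _ ⟩
    act graph u′ (act graph v x)  ≡⟨ cong (act graph u′) (act-cong v≈v′ x) ⟩
    act graph u′ (act graph v′ x) ≡⟨ act-++ graph u′ v′ x ⟨
    act graph (u′ ++ v′) x        ∎
    where open ≡-Reasoning

  act-twist : {h : Word n → Word n} → IsHom h →
              ∀ w x → act (twist graph h) w x ≡ act graph (h w) x
  act-twist isHom []      x = sym (act-cong (hom-identity isHom) x)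
  act-twist {h} isHom (i ∷ w) x = begin
    act graph (h [ i ]) (act (twist graph h) w x) ≡⟨ cong (act graph (h [ i ])) (act-twist isHom w x) ⟩
    act graph (h [ i ]) (act graph (h w) x)       ≡⟨ act-++ graph (h [ i ]) (h w) x ⟨
    act graph (h [ i ] ++ h w) x                  ≡⟨ act-cong (IsHom.hom-mult isHom [ i ] w) x ⟨
    act graph (h (i ∷ w)) x                       ∎
    where open ≡-Reasoning

theorem6p3 : ∀ {n m} (V : VoltageOperator n m)
    (τ : Automorphism (Premaniplex.graph (VoltageOperator.Y V)))
    (τ# : Word n → Word n) → IsHom τ#
    → (∀ W → τ# (VoltageOperator.η V W) ≈ VoltageOperator.η V (W ▸ τ))
    → (X : Premaniplex n)
    → Isomorphism (twist (Premaniplex.graph X) τ# ⋊ V) (Premaniplex.graph X ⋊ V)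
theorem6p3 V τ τ# isHom η-equivariant X = record
  { to      = λ { (x , y) → x , τ.to y }
  ; from    = λ { (x , y) → x , τ.from y }
  ; from∘to = λ { (x , y) → cong (x ,_) (τ.from∘to y) }
  ; to∘from = λ { (x , y) → cong (x ,_) (τ.to∘from y) }
  ; to-adj  = λ { i (x , y) → cong₂ _,_ (voltage-moves-alike i y x) (τ.to-adj i y) }
  }
  where
    module τ = Isomorphism τ
    open VoltageOperator V using (η)

    voltage-moves-alike : ∀ i y x →
      act (twist (Premaniplex.graph X) τ#) (η (path y [ i ])) x
        ≡ act (Premaniplex.graph X) (η (path (τ.to y) [ i ])) x
    voltage-moves-alike i y x =
      trans (act-twist X isHom _ x) (act-cong X (η-equivariant (path y [ i ])) x)
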